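{- Let $\mathcal{R}$ be a set of formula-to-formula rules such that $\mathcal{R}_{\mathsf{C}}\subseteq\mathcal{R}$. Then the inter-derivability relation $\{\langle\varphi,\psi\rangle:\varphi\vdash_{\mathcal{R}_\omega}\psi\text{ and }\psi\vdash_{\mathcal{R}_\omega}\varphi\}$ is a congruence of the formula algebra $\mathbf{Fm}$.
   Context: Language: binary $\land,\lor$, unary $\neg$, constants $\bot,\top$; $\mathbf{Fm}$ is the formula algebra over a countably infinite set of variables. A formula-to-formula rule is a pair $\frac{\varphi}{\psi}$ of formulas; $\vdash_{\mathcal{R}}$ denotes Hilbert derivability using substitution instances of rules in $\mathcal{R}$. $\mathcal{R}_{\mathsf{C}}=\{\frac{p\land q}{q\land p},\frac{p\lor q}{q\lor p}\}$. Given $\mathcal{R}$, fix fresh variables $q_0,q_1,\dots$ not occurring in $\mathcal{R}$, and set $\mathcal{R}_0=\mathcal{R}$, $\mathcal{R}_{n+1}=\{\frac{\varphi\lor q_n}{\psi\lor q_n},\frac{\varphi\land q_n}{\psi\land q_n},\frac{\neg\psi}{\neg\varphi}:\frac{\varphi}{\psi}\in\mathcal{R}_n\}$, $\mathcal{R}_\omega=\bigcup_{n<\omega}\mathcal{R}_n$. -}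

module Defs where

open import Data.Nat using (ℕ; zero; suc)
open import Data.Product using (_×_; _,_; Σ; ∃; ∃-syntax; proj₁; proj₂)
open import Data.Sum using (_⊎_)
open import Function.Definitions using (Injective)
open import Relation.Binary.PropositionalEquality using (_≡_)
open import Relation.Binary.Construct.Closure.ReflexiveTransitive using (Star)

Var : Set
Var = ℕ

infixr 6 _∧_
infixr 5 _∨_
data Fm : Set where
  var : Var → Fm
  _∧_ _∨_ : Fm → Fm → Fm
  ¬_ : Fm → Fm
  ⊥' ⊤' : Fm

Subst : Set
Subst = Var → Fm

_[_] : Fm → Subst → Fm
var x [ σ ] = σ x
(φ ∧ ψ) [ σ ] = (φ [ σ ]) ∧ (ψ [ σ ])
(φ ∨ ψ) [ σ ] = (φ [ σ ]) ∨ (ψ [ σ ])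
(¬ φ) [ σ ] = ¬ (φ [ σ ])
⊥' [ σ ] = ⊥'
⊤' [ σ ] = ⊤'

data _occursIn_ (x : Var) : Fm → Set where
  here  : x occursIn var x
  ∧ˡ : ∀ {φ ψ} → x occursIn φ → x occursIn (φ ∧ ψ)
  ∧ʳ : ∀ {φ ψ} → x occursIn ψ → x occursIn (φ ∧ ψ)
  ∨ˡ : ∀ {φ ψ} → x occursIn φ → x occursIn (φ ∨ ψ)
  ∨ʳ : ∀ {φ ψ} → x occursIn ψ → x occursIn (φ ∨ ψ)
  ¬i : ∀ {φ} → x occursIn φ → x occursIn (¬ φ)

-- A formula-to-formula rule φ / ψ is a pair (premise , conclusion).
Rule : Set
Rule = Fm × Fm

RuleSet : Set₁
RuleSet = Rule → Set

_⊆_ : RuleSet → RuleSet → Set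
R ⊆ S = ∀ r → R r → S r

FreshFor : Var → RuleSet → Set
FreshFor x R = ∀ φ ψ → R (φ , ψ) → (x occursIn φ → Data.Empty.⊥) × (x occursIn ψ → Data.Empty.⊥)
  where import Data.Empty

p q : Fm
p = var 0
q = var 1

data RC : RuleSet where
  comm∧ : RC (p ∧ q , q ∧ p)
  comm∨ : RC (p ∨ q , q ∨ p)

Step : RuleSet → Fm → Fm → Set
Step R χ χ' = ∃[ φ ] ∃[ ψ ] (R (φ , ψ) × ∃[ σ ] (χ ≡ φ [ σ ] × χ' ≡ ψ [ σ ]))

_⊢[_]_ : Fm → RuleSet → Fm → Set
φ ⊢[ R ] ψ = Star (Step R) φ ψ

-- The hierarchy R_n, given the fresh variables qs n = q_n.
data Rn (R : RuleSet) (qs : ℕ → Var) : ℕ → RuleSet where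
  base : ∀ {r} → R r → Rn R qs zero r
  ext∨ : ∀ {n φ ψ} → Rn R qs n (φ , ψ) → Rn R qs (suc n) (φ ∨ var (qs n) , ψ ∨ var (qs n))
  ext∧ : ∀ {n φ ψ} → Rn R qs n (φ , ψ) → Rn R qs (suc n) (φ ∧ var (qs n) , ψ ∧ var (qs n))
  ext¬ : ∀ {n φ ψ} → Rn R qs n (φ , ψ) → Rn R qs (suc n) (¬ ψ , ¬ φ)

Rω : RuleSet → (ℕ → Var) → RuleSet
Rω R qs r = ∃[ n ] Rn R qs n r

-- A congruence of the formula algebra Fm: an equivalence relation
-- compatible with all operations (∧, ∨, ¬; constants trivially).
record IsCongruence (θ : Fm → Fm → Set) : Set where
  field
    refl  : ∀ {φ} → θ φ φ
    sym   : ∀ {φ ψ} → θ φ ψ → θ ψ φ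
    trans : ∀ {φ ψ χ} → θ φ ψ → θ ψ χ → θ φ χ
    cong∧ : ∀ {φ φ' ψ ψ'} → θ φ φ' → θ ψ ψ' → θ (φ ∧ ψ) (φ' ∧ ψ')
    cong∨ : ∀ {φ φ' ψ ψ'} → θ φ φ' → θ ψ ψ' → θ (φ ∨ ψ) (φ' ∨ ψ')
    cong¬ : ∀ {φ φ'} → θ φ φ' → θ (¬ φ) (¬ φ')

InterDer : RuleSet → (ℕ → Var) → Fm → Fm → Set
InterDer R qs φ ψ = (φ ⊢[ Rω R qs ] ψ) × (ψ ⊢[ Rω R qs ] φ)

-- Since q_n is fresh for R_n, a substitution may send q_n to
-- any χ without disturbing the instance of the R_n-rule, so every
-- R_ω-derivation φ ⊢ ψ yields φ ∨ χ ⊢ ψ ∨ χ, φ ∧ χ ⊢ ψ ∧ χ and ¬ ψ ⊢ ¬ φ.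
-- The commutativity rules move the context to the other side, so
-- inter-derivability is compatible with both arguments of ∧ and ∨, and with ¬
-- because it is symmetric.
module Submission where

open import Defs
open import Data.Empty using (⊥; ⊥-elim)
open import Data.Nat using (ℕ; zero; suc; _≤_; _<_; _≟_)
open import Data.Nat.Properties using (≤-refl; <⇒≤; >⇒≢)
open import Data.Product using (_,_; proj₁; proj₂)
open import Function using (id; flip)
open import Function.Definitions using (Injective)
open import Relation.Binary.PropositionalEquality using (_≡_; refl; sym; cong; cong₂)
open import Relation.Binary.Construct.Closure.ReflexiveTransitive using (ε; _◅_; _◅◅_; gmap; reverse)
open import Relation.Nullary using (yes; no)

occursIn-var : ∀ {x y} → x occursIn var y → x ≡ y
occursIn-var here = refl

[]-agree : ∀ a {σ τ : Subst} → (∀ y → y occursIn a → σ y ≡ τ y) → a [ σ ] ≡ a [ τ ]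
[]-agree (var x) h = h x here
[]-agree (a ∧ b) h = cong₂ _∧_ ([]-agree a (λ y o → h y (∧ˡ o))) ([]-agree b (λ y o → h y (∧ʳ o)))
[]-agree (a ∨ b) h = cong₂ _∨_ ([]-agree a (λ y o → h y (∨ˡ o))) ([]-agree b (λ y o → h y (∨ʳ o)))
[]-agree (¬ a) h = cong ¬_ ([]-agree a (λ y o → h y (¬i o)))
[]-agree ⊥' h = refl
[]-agree ⊤' h = refl

update : Subst → Var → Fm → Subst
update σ x χ y with y ≟ x
... | yes _ = χ
... | no _ = σ y

update-same : ∀ σ x χ → update σ x χ x ≡ χ
update-same σ x χ with x ≟ x
... | yes _ = refl
... | no x≢x = ⊥-elim (x≢x refl)

update-other : ∀ σ x χ y → (y ≡ x → ⊥) → update σ x χ y ≡ σ y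
update-other σ x χ y y≢x with y ≟ x
... | yes y≡x = ⊥-elim (y≢x y≡x)
... | no _ = refl

[]-update-fresh : ∀ a σ x χ → (x occursIn a → ⊥) → a [ update σ x χ ] ≡ a [ σ ]
[]-update-fresh a σ x χ x∉a =
  []-agree a (λ y y∈a → update-other σ x χ y (λ { refl → x∉a y∈a }))

⊢-instance : ∀ {S : RuleSet} {a b} → S (a , b) → (σ : Subst) → (a [ σ ]) ⊢[ S ] (b [ σ ])
⊢-instance r σ = (_ , _ , r , σ , refl , refl) ◅ ε

⊢-cong₂ : ∀ {S : RuleSet} (_⊙_ : Fm → Fm → Fm)
          → (∀ {φ ψ} χ → φ ⊢[ S ] ψ → (φ ⊙ χ) ⊢[ S ] (ψ ⊙ χ))
          → (∀ φ ψ → (φ ⊙ ψ) ⊢[ S ] (ψ ⊙ φ))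
          → ∀ {φ φ' ψ ψ'} → φ ⊢[ S ] φ' → ψ ⊢[ S ] ψ' → (φ ⊙ ψ) ⊢[ S ] (φ' ⊙ ψ')
⊢-cong₂ _⊙_ frame comm {φ' = φ'} {ψ = ψ} φ⊢φ' ψ⊢ψ' =
  frame ψ φ⊢φ' ◅◅ comm φ' ψ ◅◅ frame φ' ψ⊢ψ' ◅◅ comm _ φ'

module Framing (R : RuleSet) (qs : ℕ → Var) (qs-injective : Injective _≡_ _≡_ qs)
         (qs-fresh : ∀ n → FreshFor (qs n) R) where

  qs-fresh-later : ∀ {n m} → n < m → qs m occursIn var (qs n) → ⊥
  qs-fresh-later n<m o = >⇒≢ n<m (qs-injective (occursIn-var o))

  mutual
    Rn-premise-fresh : ∀ {n m a b} → Rn R qs n (a , b) → n ≤ m → qs m occursIn a → ⊥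
    Rn-premise-fresh (base r) _ = proj₁ (qs-fresh _ _ _ r)
    Rn-premise-fresh (ext∨ r) n<m (∨ˡ o) = Rn-premise-fresh r (<⇒≤ n<m) o
    Rn-premise-fresh (ext∨ r) n<m (∨ʳ o) = qs-fresh-later n<m o
    Rn-premise-fresh (ext∧ r) n<m (∧ˡ o) = Rn-premise-fresh r (<⇒≤ n<m) o
    Rn-premise-fresh (ext∧ r) n<m (∧ʳ o) = qs-fresh-later n<m o
    Rn-premise-fresh (ext¬ r) n<m (¬i o) = Rn-conclusion-fresh r (<⇒≤ n<m) o

    Rn-conclusion-fresh : ∀ {n m a b} → Rn R qs n (a , b) → n ≤ m → qs m occursIn b → ⊥
    Rn-conclusion-fresh (base r) _ = proj₂ (qs-fresh _ _ _ r)
    Rn-conclusion-fresh (ext∨ r) n<m (∨ˡ o) = Rn-conclusion-fresh r (<⇒≤ n<m) o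
    Rn-conclusion-fresh (ext∨ r) n<m (∨ʳ o) = qs-fresh-later n<m o
    Rn-conclusion-fresh (ext∧ r) n<m (∧ˡ o) = Rn-conclusion-fresh r (<⇒≤ n<m) o
    Rn-conclusion-fresh (ext∧ r) n<m (∧ʳ o) = qs-fresh-later n<m o
    Rn-conclusion-fresh (ext¬ r) n<m (¬i o) = Rn-premise-fresh r (<⇒≤ n<m) o

  private
    S : RuleSet
    S = Rω R qs

  Step-∨ʳ : ∀ {φ ψ} χ → Step S φ ψ → Step S (φ ∨ χ) (ψ ∨ χ)
  Step-∨ʳ χ (a , b , (n , r) , σ , refl , refl) =
    a ∨ var (qs n) , b ∨ var (qs n) , (suc n , ext∨ r) , update σ (qs n) χ ,
    cong₂ _∨_ (sym ([]-update-fresh a σ (qs n) χ (Rn-premise-fresh r ≤-refl)))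
              (sym (update-same σ (qs n) χ)) ,
    cong₂ _∨_ (sym ([]-update-fresh b σ (qs n) χ (Rn-conclusion-fresh r ≤-refl)))
              (sym (update-same σ (qs n) χ))

  Step-∧ʳ : ∀ {φ ψ} χ → Step S φ ψ → Step S (φ ∧ χ) (ψ ∧ χ)
  Step-∧ʳ χ (a , b , (n , r) , σ , refl , refl) =
    a ∧ var (qs n) , b ∧ var (qs n) , (suc n , ext∧ r) , update σ (qs n) χ ,
    cong₂ _∧_ (sym ([]-update-fresh a σ (qs n) χ (Rn-premise-fresh r ≤-refl)))
              (sym (update-same σ (qs n) χ)) ,
    cong₂ _∧_ (sym ([]-update-fresh b σ (qs n) χ (Rn-conclusion-fresh r ≤-refl)))
              (sym (update-same σ (qs n) χ))

  Step-¬ : ∀ {φ ψ} → Step S φ ψ → Step S (¬ ψ) (¬ φ)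
  Step-¬ (a , b , (n , r) , σ , refl , refl) = ¬ b , ¬ a , (suc n , ext¬ r) , σ , refl , refl

  ⊢-∨ʳ : ∀ {φ ψ} χ → φ ⊢[ S ] ψ → (φ ∨ χ) ⊢[ S ] (ψ ∨ χ)
  ⊢-∨ʳ χ = gmap (_∨ χ) (Step-∨ʳ χ)

  ⊢-∧ʳ : ∀ {φ ψ} χ → φ ⊢[ S ] ψ → (φ ∧ χ) ⊢[ S ] (ψ ∧ χ)
  ⊢-∧ʳ χ = gmap (_∧ χ) (Step-∧ʳ χ)

  ⊢-¬ : ∀ {φ ψ} → φ ⊢[ S ] ψ → (¬ ψ) ⊢[ S ] (¬ φ)
  ⊢-¬ φ⊢ψ = reverse id (gmap {U = flip (Step S)} ¬_ Step-¬ φ⊢ψ)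

p,q≔ : Fm → Fm → Subst
p,q≔ φ ψ zero = φ
p,q≔ φ ψ (suc _) = ψ

lemma3p1 : (R : RuleSet) (qs : ℕ → Var)
    → Injective _≡_ _≡_ qs
    → (∀ n → FreshFor (qs n) R)
    → RC ⊆ R
    → IsCongruence (InterDer R qs)
lemma3p1 R qs inj fresh RC⊆R = record
  { refl  = ε , ε
  ; sym   = λ { (φ⊢ψ , ψ⊢φ) → ψ⊢φ , φ⊢ψ }
  ; trans = λ { (φ⊢ψ , ψ⊢φ) (ψ⊢χ , χ⊢ψ) → φ⊢ψ ◅◅ ψ⊢χ , χ⊢ψ ◅◅ ψ⊢φ }
  ; cong∧ = λ { (φ⊢φ' , φ'⊢φ) (ψ⊢ψ' , ψ'⊢ψ) → cong∧ φ⊢φ' ψ⊢ψ' , cong∧ φ'⊢φ ψ'⊢ψ }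
  ; cong∨ = λ { (φ⊢φ' , φ'⊢φ) (ψ⊢ψ' , ψ'⊢ψ) → cong∨ φ⊢φ' ψ⊢ψ' , cong∨ φ'⊢φ ψ'⊢ψ }
  ; cong¬ = λ { (φ⊢φ' , φ'⊢φ) → ⊢-¬ φ'⊢φ , ⊢-¬ φ⊢φ' }
  }
  where
  open Framing R qs inj fresh

  comm∧-instance : ∀ φ ψ → (φ ∧ ψ) ⊢[ Rω R qs ] (ψ ∧ φ)
  comm∧-instance φ ψ = ⊢-instance (0 , base (RC⊆R _ comm∧)) (p,q≔ φ ψ)

  comm∨-instance : ∀ φ ψ → (φ ∨ ψ) ⊢[ Rω R qs ] (ψ ∨ φ)
  comm∨-instance φ ψ = ⊢-instance (0 , base (RC⊆R _ comm∨)) (p,q≔ φ ψ)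

  cong∧ : ∀ {φ φ' ψ ψ'} → φ ⊢[ Rω R qs ] φ' → ψ ⊢[ Rω R qs ] ψ' → (φ ∧ ψ) ⊢[ Rω R qs ] (φ' ∧ ψ')
  cong∧ = ⊢-cong₂ _∧_ ⊢-∧ʳ comm∧-instance

  cong∨ : ∀ {φ φ' ψ ψ'} → φ ⊢[ Rω R qs ] φ' → ψ ⊢[ Rω R qs ] ψ' → (φ ∨ ψ) ⊢[ Rω R qs ] (φ' ∨ ψ')
  cong∨ = ⊢-cong₂ _∨_ ⊢-∨ʳ comm∨-instance
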